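{- For every $n\ge1$, the logic $\mathrm{S4}\mathbb{C}_n$ is sound and complete for validity in the class of all finite reflexive transitive frames that have circumference at most $n$.
   Context: Modal formulas are built from variables by $\top,\neg,\wedge,\Box$, with $\Diamond=\neg\Box\neg$, $\Box^*\varphi=\varphi\wedge\Box\varphi$; validity in a frame means truth at every point of every Kripke model on it. A normal logic is a set of formulas containing all tautologies and all instances of $\Box(\varphi\to\psi)\to(\Box\varphi\to\Box\psi)$, closed under modus ponens, $\Box$-generalisation and uniform substitution. Define $\mathbb{P}_0(\varphi_0)=\Diamond\varphi_0$, $\mathbb{P}_n(\varphi_0,\dots,\varphi_n)=\Diamond(\varphi_1\wedge\mathbb{P}_{n-1}(\varphi_0,\varphi_2,\dots,\varphi_n))$ for $n>0$; $\mathbb{D}_n=\bigwedge_{i<j\le n}\neg(\varphi_i\wedge\varphi_j)$; $\mathbb{C}_n$ is the scheme $\Box^*\mathbb{D}_n\to(\Diamond\varphi_0\to\Diamond(\varphi_0\wedge\neg\mathbb{P}_n))$. $\mathrm{S4}\mathbb{C}_n$ is the smallest normal logic containing all instances of $\Box\varphi\to\Box\Box\varphi$, $\Box\varphi\to\varphi$ and $\mathbb{C}_n$. The circumference of a frame is the supremum of lengths $n$ of cycles (sequences of $n$ distinct points $x_0,\dots,x_{n-1}$ with $x_0R\cdots Rx_{n-1}Rx_0$), and 0 if there are none. -}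

module Defs where

open import Data.Nat using (ℕ; zero; suc; _≤_)
open import Data.Fin using (Fin; zero; suc; inject₁; fromℕ)
open import Data.Bool using (Bool; true; false; not; _∧_; _∨_)
open import Data.Vec using (Vec; []; _∷_)
open import Data.Product using (_×_)
open import Relation.Binary.PropositionalEquality using (_≡_)

data Form : Set where
  var  : ℕ → Form
  ⊤'   : Form
  ¬'_  : Form → Form
  _∧'_ : Form → Form → Form
  □'_  : Form → Form

infixr 6 _∧'_
infix 7 ¬'_ □'_ ◇'_
infixr 4 _⇒'_

_⇒'_ : Form → Form → Form
φ ⇒' ψ = ¬' (φ ∧' ¬' ψ)

◇'_ : Form → Form
◇' φ = ¬' □' ¬' φ

□*_ : Form → Form
□* φ = φ ∧' □' φ

-- Propositional tautologies: formulas true under every Boolean valuation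
-- assigning truth values to the propositional atoms (variables) and to the
-- boxed subformulas □ψ (treated as atoms).

propEval : (Form → Bool) → Form → Bool
propEval v (var p)   = v (var p)
propEval v ⊤'        = true
propEval v (¬' φ)    = not (propEval v φ)
propEval v (φ ∧' ψ)  = propEval v φ ∧ propEval v ψ
propEval v (□' φ)    = v (□' φ)

Tautology : Form → Set
Tautology φ = (v : Form → Bool) → propEval v φ ≡ true

subst : (ℕ → Form) → Form → Form
subst s (var p)  = s p
subst s ⊤'       = ⊤'
subst s (¬' φ)   = ¬' subst s φ
subst s (φ ∧' ψ) = subst s φ ∧' subst s ψ
subst s (□' φ)   = □' subst s φ

-- ℙ φ₀ [φ₁ … φₖ] = ℙ_k(φ₀, φ₁, … , φₖ)
ℙ : ∀ {k} → Form → Vec Form k → Form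
ℙ φ₀ []        = ◇' φ₀
ℙ φ₀ (φ₁ ∷ φs) = ◇' (φ₁ ∧' ℙ φ₀ φs)

disjWith : ∀ {k} → Form → Vec Form k → Form
disjWith x []       = ⊤'
disjWith x (y ∷ ys) = ¬' (x ∧' y) ∧' disjWith x ys

𝔻 : ∀ {k} → Vec Form k → Form
𝔻 []       = ⊤'
𝔻 (x ∷ xs) = disjWith x xs ∧' 𝔻 xs

ℂ : ∀ {n} → Form → Vec Form n → Form
ℂ φ₀ φs = □* 𝔻 (φ₀ ∷ φs) ⇒' (◇' φ₀ ⇒' ◇' (φ₀ ∧' ¬' ℙ φ₀ φs))

data S4C (n : ℕ) : Form → Set where
  taut : ∀ {φ} → Tautology φ → S4C n φ
  axK  : ∀ φ ψ → S4C n (□' (φ ⇒' ψ) ⇒' (□' φ ⇒' □' ψ))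
  ax4  : ∀ φ → S4C n (□' φ ⇒' □' □' φ)
  axT  : ∀ φ → S4C n (□' φ ⇒' φ)
  axC  : ∀ φ₀ (φs : Vec Form n) → S4C n (ℂ φ₀ φs)
  mp   : ∀ {φ ψ} → S4C n (φ ⇒' ψ) → S4C n φ → S4C n ψ
  nec  : ∀ {φ} → S4C n φ → S4C n (□' φ)
  usub : ∀ {φ} (s : ℕ → Form) → S4C n φ → S4C n (subst s φ)

allFin : ∀ {m} → (Fin m → Bool) → Bool
allFin {zero}  f = true
allFin {suc m} f = f zero ∧ allFin (λ i → f (suc i))

sat : ∀ {m} → (Fin m → Fin m → Bool) → (ℕ → Fin m → Bool) → Fin m → Form → Bool
sat R V w (var p)  = V p w
sat R V w ⊤'       = true
sat R V w (¬' φ)   = not (sat R V w φ)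
sat R V w (φ ∧' ψ) = sat R V w φ ∧ sat R V w ψ
sat R V w (□' φ)   = allFin (λ u → not (R w u) ∨ sat R V u φ)

ValidIn : ∀ {m} → (Fin m → Fin m → Bool) → Form → Set
ValidIn {m} R φ = (V : ℕ → Fin m → Bool) (w : Fin m) → sat R V w φ ≡ true

Refl : ∀ {m} → (Fin m → Fin m → Bool) → Set
Refl {m} R = (x : Fin m) → R x x ≡ true

Trans : ∀ {m} → (Fin m → Fin m → Bool) → Set
Trans {m} R = (x y z : Fin m) → R x y ≡ true → R y z ≡ true → R x z ≡ true

-- A cycle of length suc j: distinct points x₀ … x_j with x₀ R x₁ R … R x_j R x₀.
IsCycle : ∀ {m} → (Fin m → Fin m → Bool) → (j : ℕ) → (Fin (suc j) → Fin m) → Set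
IsCycle {m} R j x =
  ((a b : Fin (suc j)) → x a ≡ x b → a ≡ b)
  × ((i : Fin j) → R (x (inject₁ i)) (x (suc i)) ≡ true)
  × (R (x (fromℕ j)) (x zero) ≡ true)

CircumferenceAtMost : ∀ {m} → ℕ → (Fin m → Fin m → Bool) → Set
CircumferenceAtMost {m} n R =
  (j : ℕ) (x : Fin (suc j) → Fin m) → IsCycle R j x → suc j ≤ n

ValidFinS4Circ : ℕ → Form → Set
ValidFinS4Circ n φ =
  (m : ℕ) (R : Fin m → Fin m → Bool) → Refl R → Trans R →
  CircumferenceAtMost n R → ValidIn R φ

-- Soundness: given □*𝔻 and ◇φ₀ at w, take a φ₀-successor x of w whose cluster is maximal
-- among those of φ₀-successors.  If x satisfied ℙ, the path x R p₁ R … R pₙ R y to a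
-- φ₀-point y would return to x's cluster, giving a cycle y, p₁, …, pₙ of n + 1 points that
-- are distinct because 𝔻 makes their labels exclusive.
--
-- Completeness: let I be the conjunction of the ℂₙ-instances whose arguments are
-- characteristic formulas of atoms (truth assignments) over the subformulas of φ.  If φ is
-- not derivable, neither is □I ⇒ φ, so the finite model property of S4 gives a finite
-- preorder with □I and ¬φ at a point w.  Thinning the clusters of the cone of w down to
-- their essential points preserves the subformulas of φ and leaves only cycles of
-- essential points of one cluster with distinct types; n + 1 of them would contradict the
-- instance of ℂₙ for their types.

module Submission where

open import Defs
open import Data.Nat using (ℕ; zero; suc; _≤_; _<_)
import Data.Nat.Properties as ℕ
open import Data.Fin as Fin using (Fin; zero; suc; inject₁; fromℕ; toℕ)
import Data.Fin.Properties as Fin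
open import Data.Fin.Subset as Subset using (Subset; _⊂_; ∣_∣)
open import Data.Fin.Subset.Properties using (p⊂q⇒∣p∣<∣q∣)
open import Data.Bool using (Bool; true; false; not; _∧_; _∨_)
open import Data.Bool.ListAction using (all; any)
import Data.Bool.Properties as Bool
open import Data.List as List using (List; []; _∷_)
open import Data.List.Extrema ℕ.≤-totalOrder using (argmin; argmin-all; f[argmin]≤f[xs])
open import Data.List.Membership.Propositional using (_∈_; _∉_)
open import Data.List.Membership.Propositional.Properties
  using (∈-filter⁺; ∈-filter⁻; ∈-allFin; ∈-lookup; ∈-++⁺ˡ; ∈-++⁺ʳ; ∈-++⁻; ∈-map⁺; ∈-map⁻;
         ∈-cartesianProductWith⁺; ∈-cartesianProductWith⁻)
open import Data.List.Relation.Unary.Any using (here; there)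
import Data.List.Relation.Unary.Any as Any
import Data.List.Relation.Unary.Any.Properties as Any
import Data.List.Properties as List
open import Data.List.Relation.Unary.All as All using (All; []; _∷_)
import Data.List.Relation.Unary.All.Properties as All
open import Data.Vec as Vec using (Vec; []; _∷_; lookup; tabulate)
import Data.Vec.Properties as Vec
open import Data.Product using (_×_; _,_; proj₁; proj₂; Σ; Σ-syntax)
import Data.Product.Properties as Product
open import Data.Sum using (_⊎_; inj₁; inj₂)
open import Data.Empty using (⊥; ⊥-elim)
open import Relation.Nullary using (¬_; Dec; yes; no; does; ¬?; _×-dec_)
import Relation.Nullary.Decidable as Dec
open import Relation.Binary using (DecidableEquality; tri<; tri≈; tri>)
open import Function using (_∘_)
open import Relation.Binary.PropositionalEquality using (_≡_; _≢_; refl; sym; trans; cong; cong₂)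
import Relation.Binary.PropositionalEquality as ≡

∧-true⁻ˡ : ∀ {a b} → a ∧ b ≡ true → a ≡ true
∧-true⁻ˡ {true} _ = refl

∧-true⁻ʳ : ∀ {a b} → a ∧ b ≡ true → b ≡ true
∧-true⁻ʳ {true} e = e

∧-true⁺ : ∀ {a b} → a ≡ true → b ≡ true → a ∧ b ≡ true
∧-true⁺ refl refl = refl

∧-false⁻ : ∀ {a b} → a ∧ b ≡ false → a ≡ false ⊎ b ≡ false
∧-false⁻ {false} _ = inj₁ refl
∧-false⁻ {true} e = inj₂ e

∨-true⁻ : ∀ {a b} → a ∨ b ≡ true → a ≡ true ⊎ b ≡ true
∨-true⁻ {true} _ = inj₁ refl
∨-true⁻ {false} e = inj₂ e

∨-true⁺ˡ : ∀ {a b} → a ≡ true → a ∨ b ≡ true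
∨-true⁺ˡ refl = refl

∨-true⁺ʳ : ∀ {a b} → b ≡ true → a ∨ b ≡ true
∨-true⁺ʳ {true} _ = refl
∨-true⁺ʳ {false} e = e

∨-false⁻ : ∀ {a b} → a ∨ b ≡ false → a ≡ false × b ≡ false
∨-false⁻ {false} e = refl , e

not-true⁻ : ∀ {a} → not a ≡ true → a ≡ false
not-true⁻ {false} _ = refl

not-false⁻ : ∀ {a} → not a ≡ false → a ≡ true
not-false⁻ {true} _ = refl

not-true⁺ : ∀ {a} → a ≡ false → not a ≡ true
not-true⁺ refl = refl

not-false⁺ : ∀ {a} → a ≡ true → not a ≡ false
not-false⁺ refl = refl

true≢false : ∀ {b} → b ≡ true → b ≡ false → ⊥
true≢false refl ()

does-true⁻ : ∀ {P : Set} (P? : Dec P) → does P? ≡ true → P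
does-true⁻ (yes p) _ = p

≟-true⁻ : ∀ {a b} → does (a Bool.≟ b) ≡ true → a ≡ b
≟-true⁻ {a} {b} = does-true⁻ (a Bool.≟ b)

allFin-true⁻ : ∀ {m} (f : Fin m → Bool) → allFin f ≡ true → ∀ u → f u ≡ true
allFin-true⁻ {suc m} f e zero = ∧-true⁻ˡ e
allFin-true⁻ {suc m} f e (suc u) = allFin-true⁻ (λ i → f (suc i)) (∧-true⁻ʳ {f zero} e) u

allFin-true⁺ : ∀ {m} (f : Fin m → Bool) → (∀ u → f u ≡ true) → allFin f ≡ true
allFin-true⁺ {zero} f h = refl
allFin-true⁺ {suc m} f h = ∧-true⁺ (h zero) (allFin-true⁺ (λ i → f (suc i)) (λ u → h (suc u)))

allFin-false⁻ : ∀ {m} (f : Fin m → Bool) → allFin f ≡ false → Σ[ u ∈ Fin m ] f u ≡ false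
allFin-false⁻ {suc m} f e with f zero in eq
... | false = zero , eq
... | true with allFin-false⁻ (λ i → f (suc i)) e
...   | u , fu = suc u , fu

allFin-cong : ∀ {m} (f g : Fin m → Bool) → (∀ u → f u ≡ g u) → allFin f ≡ allFin g
allFin-cong {zero} f g h = refl
allFin-cong {suc m} f g h = cong₂ _∧_ (h zero) (allFin-cong _ _ (λ u → h (suc u)))

module _ {A : Set} (p : A → Bool) where

  all-true⁻ : ∀ {xs x} → all p xs ≡ true → x ∈ xs → p x ≡ true
  all-true⁻ {y ∷ xs} e (here refl) = ∧-true⁻ˡ e
  all-true⁻ {y ∷ xs} e (there x∈) = all-true⁻ (∧-true⁻ʳ {p y} e) x∈

  all-true⁺ : ∀ xs → (∀ {x} → x ∈ xs → p x ≡ true) → all p xs ≡ true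
  all-true⁺ [] h = refl
  all-true⁺ (y ∷ xs) h = ∧-true⁺ (h (here refl)) (all-true⁺ xs (λ x∈ → h (there x∈)))

  all-false⁻ : ∀ xs → all p xs ≡ false → Σ[ x ∈ A ] x ∈ xs × p x ≡ false
  all-false⁻ (y ∷ xs) e with p y in py
  ... | false = y , here refl , py
  ... | true with all-false⁻ xs e
  ...   | x , x∈ , px = x , there x∈ , px

  any-true⁻ : ∀ xs → any p xs ≡ true → Σ[ x ∈ A ] x ∈ xs × p x ≡ true
  any-true⁻ (y ∷ xs) e with p y in py
  ... | true = y , here refl , py
  ... | false with any-true⁻ xs e
  ...   | x , x∈ , px = x , there x∈ , px

  any-false⁻ : ∀ {xs x} → any p xs ≡ false → x ∈ xs → p x ≡ false
  any-false⁻ {y ∷ xs} e (here refl) = proj₁ (∨-false⁻ e)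
  any-false⁻ {y ∷ xs} e (there x∈) = any-false⁻ (proj₂ (∨-false⁻ {p y} e)) x∈

minimiser : ∀ {m} (P : Fin m → Bool) (f : Fin m → ℕ) {u} → P u ≡ true →
            Σ[ x ∈ Fin m ] P x ≡ true × (∀ y → P y ≡ true → f x ≤ f y)
minimiser {m} P f {u} Pu = x , argmin-all f Pu (All.all-filter P? (List.allFin m)) , minimal
  where
  P? : ∀ y → Dec (P y ≡ true)
  P? y = P y Bool.≟ true
  candidates : List (Fin m)
  candidates = List.filter P? (List.allFin m)
  x : Fin m
  x = argmin f u candidates
  minimal : ∀ y → P y ≡ true → f x ≤ f y
  minimal y Py = All.lookup (f[argmin]≤f[xs] u candidates) (∈-filter⁺ P? (∈-allFin y) Py)

Chain : ∀ {m k} → (Fin m → Fin m → Bool) → Fin m → Vec (Fin m) k → Fin m → Set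
Chain R a [] b = R a b ≡ true
Chain R a (p ∷ ps) b = R a p ≡ true × Chain R p ps b

chain-steps : ∀ {m k} {R : Fin m → Fin m → Bool} {a b} (ps : Vec (Fin m) k) → Chain R a ps b →
  (∀ i → R (lookup (a ∷ ps) (inject₁ i)) (lookup (a ∷ ps) (suc i)) ≡ true)
  × R (lookup (a ∷ ps) (fromℕ k)) b ≡ true
chain-steps [] c = (λ ()) , c
chain-steps (p ∷ ps) (r , c) with chain-steps ps c
... | steps , last = (λ { zero → r ; (suc i) → steps i }) , last

chain-within : ∀ {m k} {R : Fin m → Fin m → Bool} (Q : Fin m → Set) →
  (∀ {a b} → Q a → Q b → R a b ≡ true) → ∀ {a b} (ps : Vec (Fin m) k) →
  Q a → (∀ i → Q (lookup ps i)) → Q b → Chain R a ps b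
chain-within Q related [] Qa Qps Qb = related Qa Qb
chain-within Q related (p ∷ ps) Qa Qps Qb =
  related Qa (Qps zero) , chain-within Q related ps (Qps zero) (λ i → Qps (suc i)) Qb

module Semantics {m : ℕ} (R : Fin m → Fin m → Bool) (V : ℕ → Fin m → Bool) where

  infix 4.5 _⊨_
  _⊨_ : Fin m → Form → Bool
  w ⊨ φ = sat R V w φ

  □-elim : ∀ {w u} φ → w ⊨ □' φ ≡ true → R w u ≡ true → u ⊨ φ ≡ true
  □-elim {w} {u} φ e r with allFin-true⁻ (λ u → not (R w u) ∨ (u ⊨ φ)) e u
  ... | h rewrite r = h

  □-intro : ∀ {w} φ → (∀ u → R w u ≡ true → u ⊨ φ ≡ true) → w ⊨ □' φ ≡ true
  □-intro {w} φ h = allFin-true⁺ (λ u → not (R w u) ∨ (u ⊨ φ)) (λ u → go u (R w u) refl)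
    where
    go : ∀ u b → R w u ≡ b → not b ∨ (u ⊨ φ) ≡ true
    go u true e = h u e
    go u false e = refl

  □-false⁻ : ∀ {w} φ → w ⊨ □' φ ≡ false → Σ[ u ∈ Fin m ] R w u ≡ true × u ⊨ φ ≡ false
  □-false⁻ {w} φ e with allFin-false⁻ (λ u → not (R w u) ∨ (u ⊨ φ)) e
  ... | u , fu with ∨-false⁻ {not (R w u)} fu
  ...   | Rwu , φu = u , not-false⁻ Rwu , φu

  □-false⁺ : ∀ {w u} φ → R w u ≡ true → u ⊨ φ ≡ false → w ⊨ □' φ ≡ false
  □-false⁺ {w} φ r φu with w ⊨ □' φ in e
  ... | false = refl
  ... | true = ⊥-elim (true≢false (□-elim φ e r) φu)

  ◇-intro : ∀ {w u} φ → R w u ≡ true → u ⊨ φ ≡ true → w ⊨ ◇' φ ≡ true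
  ◇-intro φ r φu = not-true⁺ (□-false⁺ (¬' φ) r (not-false⁺ φu))

  ◇-elim : ∀ {w} φ → w ⊨ ◇' φ ≡ true → Σ[ u ∈ Fin m ] R w u ≡ true × u ⊨ φ ≡ true
  ◇-elim φ e with □-false⁻ (¬' φ) (not-true⁻ e)
  ... | u , r , ¬φu = u , r , not-false⁻ ¬φu

  ⇒-intro : ∀ {w} φ ψ → (w ⊨ φ ≡ true → w ⊨ ψ ≡ true) → w ⊨ (φ ⇒' ψ) ≡ true
  ⇒-intro {w} φ ψ h with w ⊨ φ | w ⊨ ψ | h
  ... | false | _ | _ = refl
  ... | true | true | _ = refl
  ... | true | false | h′ = ⊥-elim (true≢false (h′ refl) refl)

  ⇒-elim : ∀ {w} φ ψ → w ⊨ (φ ⇒' ψ) ≡ true → w ⊨ φ ≡ true → w ⊨ ψ ≡ true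
  ⇒-elim {w} φ ψ e a rewrite a with w ⊨ ψ
  ... | true = refl

  ℙ-elim : ∀ {k x} φ₀ (φs : Vec Form k) → x ⊨ ℙ φ₀ φs ≡ true →
    Σ[ ps ∈ Vec (Fin m) k ] Σ[ y ∈ Fin m ] Chain R x ps y ×
      (∀ i → lookup ps i ⊨ lookup φs i ≡ true) × y ⊨ φ₀ ≡ true
  ℙ-elim φ₀ [] e with ◇-elim φ₀ e
  ... | y , r , φ₀y = [] , y , r , (λ ()) , φ₀y
  ℙ-elim φ₀ (φ ∷ φs) e with ◇-elim (φ ∧' ℙ φ₀ φs) e
  ... | u , r , h with ℙ-elim φ₀ φs (∧-true⁻ʳ {u ⊨ φ} h)
  ...   | ps , y , c , labels , φ₀y =
          u ∷ ps , y , (r , c) , (λ { zero → ∧-true⁻ˡ h ; (suc i) → labels i }) , φ₀y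

  ℙ-intro : ∀ {k x y} φ₀ (φs : Vec Form k) (ps : Vec (Fin m) k) → Chain R x ps y →
    (∀ i → lookup ps i ⊨ lookup φs i ≡ true) → y ⊨ φ₀ ≡ true → x ⊨ ℙ φ₀ φs ≡ true
  ℙ-intro φ₀ [] [] r labels φ₀y = ◇-intro φ₀ r φ₀y
  ℙ-intro φ₀ (φ ∷ φs) (p ∷ ps) (r , c) labels φ₀y =
    ◇-intro (φ ∧' ℙ φ₀ φs) r
      (∧-true⁺ (labels zero) (ℙ-intro φ₀ φs ps c (λ i → labels (suc i)) φ₀y))

  disjWith-elim : ∀ {k u} φ (φs : Vec Form k) → u ⊨ disjWith φ φs ≡ true → u ⊨ φ ≡ true →
                  ∀ i → u ⊨ lookup φs i ≡ false
  disjWith-elim {u = u} φ (ψ ∷ φs) d φu zero = exclusive (not-true⁻ (∧-true⁻ˡ d))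
    where
    exclusive : (u ⊨ φ) ∧ (u ⊨ ψ) ≡ false → u ⊨ ψ ≡ false
    exclusive e rewrite φu = e
  disjWith-elim {u = u} φ (ψ ∷ φs) d φu (suc i) =
    disjWith-elim φ φs (∧-true⁻ʳ {not ((u ⊨ φ) ∧ (u ⊨ ψ))} d) φu i

  disjWith-intro : ∀ {k u} φ (φs : Vec Form k) → (u ⊨ φ ≡ true → ∀ i → u ⊨ lookup φs i ≡ false) →
                   u ⊨ disjWith φ φs ≡ true
  disjWith-intro φ [] h = refl
  disjWith-intro {u = u} φ (ψ ∷ φs) h =
    ∧-true⁺ (exclusive (u ⊨ φ) refl) (disjWith-intro φ φs λ φu i → h φu (suc i))
    where
    exclusive : ∀ b → u ⊨ φ ≡ b → not (b ∧ (u ⊨ ψ)) ≡ true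
    exclusive false _ = refl
    exclusive true φu rewrite h φu zero = refl

  𝔻-elim : ∀ {k u} (φs : Vec Form k) → u ⊨ 𝔻 φs ≡ true → ∀ i j → i ≢ j →
           u ⊨ lookup φs i ≡ true → u ⊨ lookup φs j ≡ false
  𝔻-elim (φ ∷ φs) d zero zero i≢j _ = ⊥-elim (i≢j refl)
  𝔻-elim (φ ∷ φs) d zero (suc j) _ φu = disjWith-elim φ φs (∧-true⁻ˡ d) φu j
  𝔻-elim {u = u} (φ ∷ φs) d (suc i) zero _ φᵢu with u ⊨ φ in φu
  ... | false = refl
  ... | true = ⊥-elim (true≢false φᵢu (disjWith-elim φ φs (∧-true⁻ˡ d) φu i))
  𝔻-elim {u = u} (φ ∷ φs) d (suc i) (suc j) i≢j =
    𝔻-elim φs (∧-true⁻ʳ {u ⊨ disjWith φ φs} d) i j (λ e → i≢j (cong suc e))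

  𝔻-intro : ∀ {k u} (φs : Vec Form k) →
            (∀ i j → i ≢ j → u ⊨ lookup φs i ≡ true → u ⊨ lookup φs j ≡ false) → u ⊨ 𝔻 φs ≡ true
  𝔻-intro [] h = refl
  𝔻-intro (φ ∷ φs) h =
    ∧-true⁺ (disjWith-intro φ φs λ φu j → h zero (suc j) (λ ()) φu)
            (𝔻-intro φs λ i j i≢j → h (suc i) (suc j) (λ e → i≢j (Fin.suc-injective e)))

  distinct-by-labels : ∀ {k} (xs : Vec (Fin m) k) (φs : Vec Form k) →
    (∀ i → lookup xs i ⊨ 𝔻 φs ≡ true) → (∀ i → lookup xs i ⊨ lookup φs i ≡ true) →
    ∀ i j → lookup xs i ≡ lookup xs j → i ≡ j
  distinct-by-labels xs φs exclusive labels i j xᵢ≡xⱼ with i Fin.≟ j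
  ... | yes i≡j = i≡j
  ... | no i≢j = ⊥-elim (true≢false (labels j)
                   (≡.subst (λ x → x ⊨ lookup φs j ≡ false) xᵢ≡xⱼ
                     (𝔻-elim φs (exclusive i) i j i≢j (labels i))))

module Preorder {m} (R : Fin m → Fin m → Bool) (R-refl : Refl R) (R-trans : Trans R) where

  successors : Fin m → Subset m
  successors x = tabulate (R x)

  ∈-successors⁺ : ∀ {x y} → R x y ≡ true → y Subset.∈ successors x
  ∈-successors⁺ {x} {y} Rxy = Vec.lookup⇒[]= y (successors x) (trans (Vec.lookup∘tabulate (R x) y) Rxy)

  ∈-successors⁻ : ∀ {x y} → y Subset.∈ successors x → R x y ≡ true
  ∈-successors⁻ {x} {y} y∈ = trans (sym (Vec.lookup∘tabulate (R x) y)) (Vec.[]=⇒lookup y∈)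

  successors-⊂ : ∀ {x y} → R x y ≡ true → R y x ≡ false → successors y ⊂ successors x
  successors-⊂ {x} {y} Rxy Ryx =
    (λ {z} z∈ → ∈-successors⁺ (R-trans x y z Rxy (∈-successors⁻ z∈))) ,
    x , ∈-successors⁺ (R-refl x) , (λ x∈ → true≢false (∈-successors⁻ x∈) Ryx)

  maximal-point : ∀ (P : Fin m → Bool) {u} → P u ≡ true →
    Σ[ x ∈ Fin m ] P x ≡ true × (∀ y → P y ≡ true → R x y ≡ true → R y x ≡ true)
  maximal-point P Pu with minimiser P (λ x → ∣ successors x ∣) Pu
  ... | x , Px , fewest = x , Px , maximal
    where
    maximal : ∀ y → P y ≡ true → R x y ≡ true → R y x ≡ true
    maximal y Py Rxy with R y x in Ryx
    ... | true = refl
    ... | false = ⊥-elim (ℕ.<⇒≱ (p⊂q⇒∣p∣<∣q∣ (successors-⊂ Rxy Ryx)) (fewest y Py))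

  chain-end : ∀ {k a b} (ps : Vec (Fin m) k) → Chain R a ps b → R a b ≡ true
  chain-end [] c = c
  chain-end {a = a} {b} (p ∷ ps) (r , c) = R-trans a p b r (chain-end ps c)

  chain-prepend : ∀ {k a a′ b} (ps : Vec (Fin m) k) → R a′ a ≡ true → Chain R a ps b → Chain R a′ ps b
  chain-prepend {a = a} {a′} {b} [] r c = R-trans a′ a b r c
  chain-prepend {a = a} {a′} (p ∷ ps) r (r′ , c) = R-trans a′ a p r r′ , c

  chain-reach : ∀ {k a b} (ps : Vec (Fin m) k) → Chain R a ps b → ∀ i → R a (lookup ps i) ≡ true
  chain-reach (p ∷ ps) (r , c) zero = r
  chain-reach {a = a} (p ∷ ps) (r , c) (suc i) = R-trans a p _ r (chain-reach ps c i)

module ℂ-Validity {m} (R : Fin m → Fin m → Bool) (R-refl : Refl R) (R-trans : Trans R)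
                  (V : ℕ → Fin m → Bool) where
  open Semantics R V
  open Preorder R R-refl R-trans

  maximal-refutes-ℙ : ∀ {n} → CircumferenceAtMost n R → ∀ {w x} φ₀ (φs : Vec Form n) →
    w ⊨ □' 𝔻 (φ₀ ∷ φs) ≡ true → R w x ≡ true →
    (∀ y → R w y ∧ (y ⊨ φ₀) ≡ true → R x y ≡ true → R y x ≡ true) →
    x ⊨ ℙ φ₀ φs ≡ false
  maximal-refutes-ℙ {n} circ {w} {x} φ₀ φs □𝔻 Rwx maximal with x ⊨ ℙ φ₀ φs in ℙx
  ... | false = refl
  ... | true with ℙ-elim φ₀ φs ℙx
  ...   | ps , y , c , labels , φ₀y = ⊥-elim (ℕ.1+n≰n (circ n (lookup (y ∷ ps)) cycle))
    where
    Rxy : R x y ≡ true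
    Rxy = chain-end ps c
    Rwy : R w y ≡ true
    Rwy = R-trans w x y Rwx Rxy
    loop : Chain R y ps y
    loop = chain-prepend ps (maximal y (∧-true⁺ Rwy φ₀y) Rxy) c
    on-loop : ∀ i → lookup (y ∷ ps) i ⊨ lookup (φ₀ ∷ φs) i ≡ true
    on-loop zero = φ₀y
    on-loop (suc i) = labels i
    seen : ∀ i → R w (lookup (y ∷ ps) i) ≡ true
    seen zero = Rwy
    seen (suc i) = R-trans w y _ Rwy (chain-reach ps loop i)
    cycle : IsCycle R n (lookup (y ∷ ps))
    cycle = distinct-by-labels (y ∷ ps) (φ₀ ∷ φs) (λ i → □-elim (𝔻 (φ₀ ∷ φs)) □𝔻 (seen i)) on-loop ,
            chain-steps ps loop

  ℂ-valid : ∀ {n} → CircumferenceAtMost n R → ∀ w φ₀ (φs : Vec Form n) → w ⊨ ℂ φ₀ φs ≡ true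
  ℂ-valid circ w φ₀ φs =
    ⇒-intro (□* 𝔻 (φ₀ ∷ φs)) (◇' φ₀ ⇒' ◇' (φ₀ ∧' ¬' ℙ φ₀ φs)) λ □*𝔻 →
    ⇒-intro (◇' φ₀) (◇' (φ₀ ∧' ¬' ℙ φ₀ φs)) λ ◇φ₀ → witness (∧-true⁻ʳ {w ⊨ 𝔻 (φ₀ ∷ φs)} □*𝔻) ◇φ₀
    where
    witness : w ⊨ □' 𝔻 (φ₀ ∷ φs) ≡ true → w ⊨ ◇' φ₀ ≡ true → w ⊨ ◇' (φ₀ ∧' ¬' ℙ φ₀ φs) ≡ true
    witness □𝔻 ◇φ₀ with ◇-elim φ₀ ◇φ₀
    ... | u , Rwu , φ₀u with maximal-point (λ y → R w y ∧ (y ⊨ φ₀)) (∧-true⁺ Rwu φ₀u)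
    ...   | x , Px , maximal =
            ◇-intro (φ₀ ∧' ¬' ℙ φ₀ φs) (∧-true⁻ˡ Px)
              (∧-true⁺ (∧-true⁻ʳ {R w x} Px)
                       (not-true⁺ (maximal-refutes-ℙ circ φ₀ φs □𝔻 (∧-true⁻ˡ Px) maximal)))

propEval-sat : ∀ {m} (R : Fin m → Fin m → Bool) V w φ → propEval (sat R V w) φ ≡ sat R V w φ
propEval-sat R V w (var p) = refl
propEval-sat R V w ⊤' = refl
propEval-sat R V w (¬' φ) = cong not (propEval-sat R V w φ)
propEval-sat R V w (φ ∧' ψ) = cong₂ _∧_ (propEval-sat R V w φ) (propEval-sat R V w ψ)
propEval-sat R V w (□' φ) = refl

sat-subst : ∀ {m} (R : Fin m → Fin m → Bool) V (s : ℕ → Form) w φ →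
            sat R V w (subst s φ) ≡ sat R (λ p u → sat R V u (s p)) w φ
sat-subst R V s w (var p) = refl
sat-subst R V s w ⊤' = refl
sat-subst R V s w (¬' φ) = cong not (sat-subst R V s w φ)
sat-subst R V s w (φ ∧' ψ) = cong₂ _∧_ (sat-subst R V s w φ) (sat-subst R V s w ψ)
sat-subst R V s w (□' φ) = allFin-cong _ _ λ u → cong (not (R w u) ∨_) (sat-subst R V s u φ)

sound : ∀ n {φ} → S4C n φ → ValidFinS4Circ n φ
sound n (taut {φ} t) m R _ _ _ V w = trans (sym (propEval-sat R V w φ)) (t (sat R V w))
sound n (axK φ ψ) m R _ _ _ V w =
  ⇒-intro (□' (φ ⇒' ψ)) (□' φ ⇒' □' ψ) λ □φ⇒ψ → ⇒-intro (□' φ) (□' ψ) λ □φ →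
    □-intro ψ λ u r → ⇒-elim φ ψ (□-elim (φ ⇒' ψ) □φ⇒ψ r) (□-elim φ □φ r)
  where open Semantics R V
sound n (ax4 φ) m R _ R-trans _ V w =
  ⇒-intro (□' φ) (□' □' φ) λ □φ →
    □-intro (□' φ) λ u r → □-intro φ λ v r′ → □-elim φ □φ (R-trans w u v r r′)
  where open Semantics R V
sound n (axT φ) m R R-refl _ _ V w = ⇒-intro (□' φ) φ λ □φ → □-elim φ □φ (R-refl w)
  where open Semantics R V
sound n (axC φ₀ φs) m R R-refl R-trans circ V w = ℂ-Validity.ℂ-valid R R-refl R-trans V circ w φ₀ φs
sound n (mp {φ} {ψ} d e) m R R-refl R-trans circ V w =
  Semantics.⇒-elim R V φ ψ (sound n d m R R-refl R-trans circ V w) (sound n e m R R-refl R-trans circ V w)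
sound n (nec {φ} d) m R R-refl R-trans circ V w =
  Semantics.□-intro R V φ λ u _ → sound n d m R R-refl R-trans circ V u
sound n (usub {φ} s d) m R R-refl R-trans circ V w =
  trans (sat-subst R V s w φ) (sound n d m R R-refl R-trans circ (λ p u → sat R V u (s p)) w)

subformulas : Form → List Form
subformulas (var p) = var p ∷ []
subformulas ⊤' = ⊤' ∷ []
subformulas (¬' φ) = ¬' φ ∷ subformulas φ
subformulas (φ ∧' ψ) = φ ∧' ψ ∷ subformulas φ List.++ subformulas ψ
subformulas (□' φ) = □' φ ∷ subformulas φ

∈-subformulas-self : ∀ φ → φ ∈ subformulas φ
∈-subformulas-self (var p) = here refl
∈-subformulas-self ⊤' = here refl
∈-subformulas-self (¬' φ) = here refl
∈-subformulas-self (φ ∧' ψ) = here refl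
∈-subformulas-self (□' φ) = here refl

∈-subformulas-trans : ∀ Φ {ψ χ} → ψ ∈ subformulas Φ → χ ∈ subformulas ψ → χ ∈ subformulas Φ
∈-subformulas-trans (var p) (here refl) χ∈ = χ∈
∈-subformulas-trans ⊤' (here refl) χ∈ = χ∈
∈-subformulas-trans (¬' Φ) (here refl) χ∈ = χ∈
∈-subformulas-trans (¬' Φ) (there ψ∈) χ∈ = there (∈-subformulas-trans Φ ψ∈ χ∈)
∈-subformulas-trans (Φ ∧' Ψ) (here refl) χ∈ = χ∈
∈-subformulas-trans (Φ ∧' Ψ) (there ψ∈) χ∈ with ∈-++⁻ (subformulas Φ) ψ∈
... | inj₁ ψ∈Φ = there (∈-++⁺ˡ (∈-subformulas-trans Φ ψ∈Φ χ∈))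
... | inj₂ ψ∈Ψ = there (∈-++⁺ʳ (subformulas Φ) (∈-subformulas-trans Ψ ψ∈Ψ χ∈))
∈-subformulas-trans (□' Φ) (here refl) χ∈ = χ∈
∈-subformulas-trans (□' Φ) (there ψ∈) χ∈ = there (∈-subformulas-trans Φ ψ∈ χ∈)

module _ (Φ : Form) {χ : Form} where
  ¬-subformula : ¬' χ ∈ subformulas Φ → χ ∈ subformulas Φ
  ¬-subformula χ∈ = ∈-subformulas-trans Φ χ∈ (there (∈-subformulas-self χ))

  □-subformula : □' χ ∈ subformulas Φ → χ ∈ subformulas Φ
  □-subformula χ∈ = ∈-subformulas-trans Φ χ∈ (there (∈-subformulas-self χ))

  ∧-subformulaˡ : ∀ {θ} → χ ∧' θ ∈ subformulas Φ → χ ∈ subformulas Φ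
  ∧-subformulaˡ χ∈ = ∈-subformulas-trans Φ χ∈ (there (∈-++⁺ˡ (∈-subformulas-self χ)))

  ∧-subformulaʳ : ∀ {θ} → θ ∧' χ ∈ subformulas Φ → χ ∈ subformulas Φ
  ∧-subformulaʳ {θ} χ∈ = ∈-subformulas-trans Φ χ∈ (there (∈-++⁺ʳ (subformulas θ) (∈-subformulas-self χ)))

_≟ᶠ_ : DecidableEquality Form
var p ≟ᶠ var q = Dec.map′ (cong var) var-injective (p ℕ.≟ q)
  where
  var-injective : ∀ {p q} → var p ≡ var q → p ≡ q
  var-injective refl = refl
⊤' ≟ᶠ ⊤' = yes refl
(¬' φ) ≟ᶠ (¬' ψ) = Dec.map′ (cong ¬'_) ¬-injective (φ ≟ᶠ ψ)
  where
  ¬-injective : ∀ {φ ψ} → ¬' φ ≡ ¬' ψ → φ ≡ ψ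
  ¬-injective refl = refl
(φ ∧' φ′) ≟ᶠ (ψ ∧' ψ′) = Dec.map′ (λ (e , e′) → cong₂ _∧'_ e e′) ∧-injective (φ ≟ᶠ ψ ×-dec φ′ ≟ᶠ ψ′)
  where
  ∧-injective : ∀ {φ φ′ ψ ψ′} → φ ∧' φ′ ≡ ψ ∧' ψ′ → φ ≡ ψ × φ′ ≡ ψ′
  ∧-injective refl = refl , refl
(□' φ) ≟ᶠ (□' ψ) = Dec.map′ (cong □'_) □-injective (φ ≟ᶠ ψ)
  where
  □-injective : ∀ {φ ψ} → □' φ ≡ □' ψ → φ ≡ ψ
  □-injective refl = refl
var _ ≟ᶠ ⊤' = no λ ()
var _ ≟ᶠ (¬' _) = no λ ()
var _ ≟ᶠ (_ ∧' _) = no λ ()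
var _ ≟ᶠ (□' _) = no λ ()
⊤' ≟ᶠ var _ = no λ ()
⊤' ≟ᶠ (¬' _) = no λ ()
⊤' ≟ᶠ (_ ∧' _) = no λ ()
⊤' ≟ᶠ (□' _) = no λ ()
(¬' _) ≟ᶠ var _ = no λ ()
(¬' _) ≟ᶠ ⊤' = no λ ()
(¬' _) ≟ᶠ (_ ∧' _) = no λ ()
(¬' _) ≟ᶠ (□' _) = no λ ()
(_ ∧' _) ≟ᶠ var _ = no λ ()
(_ ∧' _) ≟ᶠ ⊤' = no λ ()
(_ ∧' _) ≟ᶠ (¬' _) = no λ ()
(_ ∧' _) ≟ᶠ (□' _) = no λ ()
(□' _) ≟ᶠ var _ = no λ ()
(□' _) ≟ᶠ ⊤' = no λ ()
(□' _) ≟ᶠ (¬' _) = no λ ()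
(□' _) ≟ᶠ (_ ∧' _) = no λ ()

bigAnd : List Form → Form
bigAnd [] = ⊤'
bigAnd (φ ∷ φs) = φ ∧' bigAnd φs

AllTrue : (Form → Bool) → List Form → Set
AllTrue v = All (λ φ → propEval v φ ≡ true)

module PropositionalValuation (v : Form → Bool) where

  ⇒-true⁺ : ∀ φ ψ → (propEval v φ ≡ true → propEval v ψ ≡ true) → propEval v (φ ⇒' ψ) ≡ true
  ⇒-true⁺ φ ψ h with propEval v φ | propEval v ψ | h
  ... | false | _ | _ = refl
  ... | true | true | _ = refl
  ... | true | false | h′ = ⊥-elim (true≢false (h′ refl) refl)

  ⇒-true⁻ : ∀ φ ψ → propEval v (φ ⇒' ψ) ≡ true → propEval v φ ≡ true → propEval v ψ ≡ true
  ⇒-true⁻ φ ψ e φv rewrite φv with propEval v ψ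
  ... | true = refl

  bigAnd-true⁻ : ∀ φs → propEval v (bigAnd φs) ≡ true → AllTrue v φs
  bigAnd-true⁻ [] _ = []
  bigAnd-true⁻ (φ ∷ φs) e = ∧-true⁻ˡ e ∷ bigAnd-true⁻ φs (∧-true⁻ʳ {propEval v φ} e)

  bigAnd-true⁺ : ∀ {φs} → AllTrue v φs → propEval v (bigAnd φs) ≡ true
  bigAnd-true⁺ [] = refl
  bigAnd-true⁺ (φv ∷ φsv) = ∧-true⁺ φv (bigAnd-true⁺ φsv)

literal : Form × Bool → Form
literal (φ , true) = φ
literal (φ , false) = ¬' φ

literal-true⁻ : ∀ v {φ b} → propEval v (literal (φ , b)) ≡ true → propEval v φ ≡ b
literal-true⁻ v {b = true} e = e
literal-true⁻ v {b = false} e = not-true⁻ e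

literal-true⁺ : ∀ v {φ b} → propEval v φ ≡ b → propEval v (literal (φ , b)) ≡ true
literal-true⁺ v {b = true} e = e
literal-true⁺ v {b = false} e = not-true⁺ e

Atom : Set
Atom = List (Form × Bool)

_≟ᵃ_ : DecidableEquality Atom
_≟ᵃ_ = List.≡-dec (Product.≡-dec _≟ᶠ_ Bool._≟_)

open import Data.List.Membership.DecPropositional _≟ᵃ_ using (_∈?_)

domain : Atom → List Form
domain = List.map proj₁

characteristic : Atom → Form
characteristic a = bigAnd (List.map literal a)

characteristic-true⁻ : ∀ v a → propEval v (characteristic a) ≡ true →
                       ∀ {φ b} → (φ , b) ∈ a → propEval v φ ≡ b
characteristic-true⁻ v a e φb∈a =
  literal-true⁻ v (All.lookup (bigAnd-true⁻ (List.map literal a) e) (∈-map⁺ literal φb∈a))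
  where open PropositionalValuation v

characteristic-true⁺ : ∀ v a → (∀ {φ b} → (φ , b) ∈ a → propEval v φ ≡ b) →
                       propEval v (characteristic a) ≡ true
characteristic-true⁺ v a h = bigAnd-true⁺ (All.map⁺ (All.tabulate λ φb∈a → literal-true⁺ v (h φb∈a)))
  where open PropositionalValuation v

-- The first recorded value; true is a junk value for formulas outside the domain.
value : Atom → Form → Bool
value [] φ = true
value ((ψ , b) ∷ a) φ with φ ≟ᶠ ψ
... | yes _ = b
... | no _ = value a φ

value-∈ : ∀ a {φ} → φ ∈ domain a → (φ , value a φ) ∈ a
value-∈ ((ψ , b) ∷ a) {φ} φ∈ with φ ≟ᶠ ψ | φ∈
... | yes refl | _ = here refl
... | no φ≢ψ | here φ≡ψ = ⊥-elim (φ≢ψ φ≡ψ)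
... | no _ | there φ∈a = there (value-∈ a φ∈a)

atomOf : (Form → Bool) → List Form → Atom
atomOf f = List.map λ φ → φ , f φ

value-atomOf : ∀ f L {φ} → φ ∈ L → value (atomOf f L) φ ≡ f φ
value-atomOf f (ψ ∷ L) {φ} φ∈ with φ ≟ᶠ ψ | φ∈
... | yes refl | _ = refl
... | no φ≢ψ | here φ≡ψ = ⊥-elim (φ≢ψ φ≡ψ)
... | no _ | there φ∈L = value-atomOf f L φ∈L

atomOf-cong : ∀ {f g} L → (∀ {φ} → φ ∈ L → f φ ≡ g φ) → atomOf f L ≡ atomOf g L
atomOf-cong [] h = refl
atomOf-cong (φ ∷ L) h = cong₂ _∷_ (cong (φ ,_) (h (here refl))) (atomOf-cong L (λ φ∈ → h (there φ∈)))

characteristic-atomOf : ∀ v f L → (∀ {φ} → φ ∈ L → f φ ≡ propEval v φ) →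
                        propEval v (characteristic (atomOf f L)) ≡ true
characteristic-atomOf v f L agrees = characteristic-true⁺ v (atomOf f L) recorded
  where
  recorded : ∀ {φ b} → (φ , b) ∈ atomOf f L → propEval v φ ≡ b
  recorded φb∈ with ∈-map⁻ (λ φ → φ , f φ) φb∈
  ... | φ , φ∈ , refl = sym (agrees φ∈)

atoms : List Form → List Atom
atoms [] = [] ∷ []
atoms (φ ∷ L) = List.cartesianProductWith (λ b a → (φ , b) ∷ a) (true ∷ false ∷ []) (atoms L)

domain-atoms : ∀ L {a} → a ∈ atoms L → domain a ≡ L
domain-atoms [] (here refl) = refl
domain-atoms (φ ∷ L) a∈ with ∈-cartesianProductWith⁻ (λ b a → (φ , b) ∷ a) (true ∷ false ∷ []) (atoms L) a∈
... | _ , a′ , _ , a′∈ , refl = cong (φ ∷_) (domain-atoms L a′∈)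

atomOf-∈-atoms : ∀ f L → atomOf f L ∈ atoms L
atomOf-∈-atoms f [] = here refl
atomOf-∈-atoms f (φ ∷ L) = ∈-cartesianProductWith⁺ (λ b a → (φ , b) ∷ a) (bool∈ (f φ)) (atomOf-∈-atoms f L)
  where
  bool∈ : ∀ b → b ∈ true ∷ false ∷ []
  bool∈ true = here refl
  bool∈ false = there (here refl)

IsBox : Form → Set
IsBox φ = Σ[ θ ∈ Form ] φ ≡ □' θ

module Derivations (n : ℕ) where
  open PropositionalValuation

  infix 3 ⊢_
  ⊢_ : Form → Set
  ⊢_ = S4C n

  bigAnd-derivable : ∀ {Γ} → All ⊢_ Γ → ⊢ bigAnd Γ
  bigAnd-derivable [] = taut λ v → refl
  bigAnd-derivable {φ ∷ Γ} (d ∷ ds) = mp (mp (taut pairing) d) (bigAnd-derivable ds)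
    where
    pairing : Tautology (φ ⇒' bigAnd Γ ⇒' φ ∧' bigAnd Γ)
    pairing v = ⇒-true⁺ v φ (bigAnd Γ ⇒' φ ∧' bigAnd Γ) λ φv →
                ⇒-true⁺ v (bigAnd Γ) (φ ∧' bigAnd Γ) (∧-true⁺ φv)

  tautological-consequence : ∀ {Γ φ} → (∀ v → AllTrue v Γ → propEval v φ ≡ true) → All ⊢_ Γ → ⊢ φ
  tautological-consequence {Γ} {φ} h ds =
    mp (taut λ v → ⇒-true⁺ v (bigAnd Γ) φ λ Γv → h v (bigAnd-true⁻ v Γ Γv)) (bigAnd-derivable ds)

  □-mono : ∀ {φ ψ} → ⊢ φ ⇒' ψ → ⊢ □' φ ⇒' □' ψ
  □-mono {φ} {ψ} d = mp (axK φ ψ) (nec d)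

  □-∧ : ∀ φ ψ → ⊢ □' φ ∧' □' ψ ⇒' □' (φ ∧' ψ)
  □-∧ φ ψ = tautological-consequence inference (□-mono pairing ∷ axK ψ (φ ∧' ψ) ∷ [])
    where
    pair : Form
    pair = ψ ⇒' φ ∧' ψ
    pairing : ⊢ φ ⇒' pair
    pairing = taut λ v → ⇒-true⁺ v φ pair λ φv → ⇒-true⁺ v ψ (φ ∧' ψ) (∧-true⁺ φv)
    inference : ∀ v → AllTrue v ((□' φ ⇒' □' pair) ∷ (□' pair ⇒' □' ψ ⇒' □' (φ ∧' ψ)) ∷ []) →
                propEval v (□' φ ∧' □' ψ ⇒' □' (φ ∧' ψ)) ≡ true
    inference v (h₁ ∷ h₂ ∷ []) = ⇒-true⁺ v (□' φ ∧' □' ψ) (□' (φ ∧' ψ)) λ □φ∧□ψ →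
      ⇒-true⁻ v (□' ψ) (□' (φ ∧' ψ))
        (⇒-true⁻ v (□' pair) (□' ψ ⇒' □' (φ ∧' ψ)) h₂ (⇒-true⁻ v (□' φ) (□' pair) h₁ (∧-true⁻ˡ □φ∧□ψ)))
        (∧-true⁻ʳ {propEval v (□' φ)} □φ∧□ψ)

  boxes-4 : ∀ {Γ} → All IsBox Γ → ⊢ bigAnd Γ ⇒' □' bigAnd Γ
  boxes-4 [] = mp (taut λ v → ⇒-true⁺ v (□' ⊤') (⊤' ⇒' □' ⊤') λ □⊤ → ⇒-true⁺ v ⊤' (□' ⊤') λ _ → □⊤)
                  (nec (taut λ v → refl))
  boxes-4 {□' θ ∷ Γ} ((θ , refl) ∷ bs) =
    tautological-consequence inference (ax4 θ ∷ boxes-4 bs ∷ □-∧ (□' θ) (bigAnd Γ) ∷ [])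
    where
    G : Form
    G = bigAnd Γ
    inference : ∀ v → AllTrue v ((□' θ ⇒' □' □' θ) ∷ (G ⇒' □' G) ∷ (□' □' θ ∧' □' G ⇒' □' (□' θ ∧' G)) ∷ []) →
                propEval v (□' θ ∧' G ⇒' □' (□' θ ∧' G)) ≡ true
    inference v (h₁ ∷ h₂ ∷ h₃ ∷ []) = ⇒-true⁺ v (□' θ ∧' G) (□' (□' θ ∧' G)) λ □θ∧G →
      ⇒-true⁻ v (□' □' θ ∧' □' G) (□' (□' θ ∧' G)) h₃
        (∧-true⁺ (⇒-true⁻ v (□' θ) (□' □' θ) h₁ (∧-true⁻ˡ □θ∧G))
                 (⇒-true⁻ v G (□' G) h₂ (∧-true⁻ʳ {propEval v (□' θ)} □θ∧G)))

FiniteCountermodel : Form → Set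
FiniteCountermodel φ = Σ[ m ∈ ℕ ] Σ[ R ∈ (Fin m → Fin m → Bool) ] Refl R × Trans R ×
                       Σ[ V ∈ (ℕ → Fin m → Bool) ] Σ[ w ∈ Fin m ] sat R V w φ ≡ false

-- The finite model property of S4 by elimination: atoms over the subformulas of Φ are
-- discarded while locally inconsistent or while some false □χ has no surviving
-- □-successor refuting χ, and every discarded atom is refuted in S4.
module Elimination (n : ℕ) (Φ : Form) where
  open Derivations n
  open PropositionalValuation

  L : List Form
  L = subformulas Φ

  candidates : List Atom
  candidates = atoms L

  value-characteristic : ∀ v {a φ} → a ∈ candidates → φ ∈ L → propEval v (characteristic a) ≡ true →
                         value a φ ≡ propEval v φ
  value-characteristic v {a} a∈ φ∈ e =
    sym (characteristic-true⁻ v a e (value-∈ a (≡.subst (_ ∈_) (sym (domain-atoms L a∈)) φ∈)))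

  Refuted : Atom → Set
  Refuted a = ⊢ ¬' characteristic a

  refuted-by : ∀ {Γ a} → (∀ v → AllTrue v Γ → propEval v (characteristic a) ≡ true → ⊥) →
               All ⊢_ Γ → Refuted a
  refuted-by h = tautological-consequence λ v Γv → not-true⁺ (Bool.¬-not (h v Γv))

  derivable-if-refuted : ∀ (p : Atom → Bool) {ψ} → (∀ {b} → b ∈ candidates → p b ≡ true → Refuted b) →
                         (∀ v → propEval v ψ ≡ false → p (atomOf (propEval v) L) ≡ true) → ⊢ ψ
  derivable-if-refuted p {ψ} refuted forced =
    tautological-consequence holds (All.map⁺ (All.tabulate refuted-filtered))
    where
    p? : ∀ b → Dec (p b ≡ true)
    p? b = p b Bool.≟ true
    refuted-filtered : ∀ {b} → b ∈ List.filter p? candidates → Refuted b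
    refuted-filtered b∈ with ∈-filter⁻ p? {xs = candidates} b∈
    ... | b∈candidates , pb = refuted b∈candidates pb
    holds : ∀ v → AllTrue v (List.map (λ b → ¬' characteristic b) (List.filter p? candidates)) →
            propEval v ψ ≡ true
    holds v refutations with propEval v ψ in ψv
    ... | true = refl
    ... | false = ⊥-elim (true≢false (characteristic-atomOf v (propEval v) L (λ _ → refl))
                    (not-true⁻ (All.lookup refutations (∈-map⁺ (λ b → ¬' characteristic b)
                      (∈-filter⁺ p? (atomOf-∈-atoms (propEval v) L) (forced v ψv))))))

  locallyConsistentAt : Atom → Form → Bool
  locallyConsistentAt a (var p) = true
  locallyConsistentAt a ⊤' = value a ⊤'
  locallyConsistentAt a (¬' χ) = does (value a (¬' χ) Bool.≟ not (value a χ))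
  locallyConsistentAt a (χ ∧' θ) = does (value a (χ ∧' θ) Bool.≟ (value a χ ∧ value a θ))
  locallyConsistentAt a (□' χ) = not (value a (□' χ)) ∨ value a χ

  consistent : Atom → Bool
  consistent a = all (locallyConsistentAt a) L

  T-instance : Form → Form
  T-instance (□' χ) = □' χ ⇒' χ
  T-instance _ = ⊤'

  T-instance-derivable : ∀ φ → ⊢ T-instance φ
  T-instance-derivable (var p) = taut λ v → refl
  T-instance-derivable ⊤' = taut λ v → refl
  T-instance-derivable (¬' φ) = taut λ v → refl
  T-instance-derivable (φ ∧' ψ) = taut λ v → refl
  T-instance-derivable (□' φ) = axT φ

  refute-inconsistent : ∀ {a} → a ∈ candidates → consistent a ≡ false → Refuted a
  refute-inconsistent {a} a∈ inconsistent =
    refuted-by satisfiable⇒consistent (All.map⁺ (All.tabulate {xs = L} λ {φ} _ → T-instance-derivable φ))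
    where
    satisfiable⇒consistent : ∀ v → AllTrue v (List.map T-instance L) →
                             propEval v (characteristic a) ≡ true → ⊥
    satisfiable⇒consistent v T-valid e =
      true≢false (all-true⁺ (locallyConsistentAt a) L λ φ∈ → local _ φ∈) inconsistent
      where
      val : ∀ {φ} → φ ∈ L → value a φ ≡ propEval v φ
      val φ∈ = value-characteristic v a∈ φ∈ e
      local : ∀ φ → φ ∈ L → locallyConsistentAt a φ ≡ true
      local (var p) _ = refl
      local ⊤' φ∈ = val φ∈
      local (¬' χ) φ∈ = Dec.dec-true (_ Bool.≟ _) (trans (val φ∈) (cong not (sym (val (¬-subformula Φ φ∈)))))
      local (χ ∧' θ) φ∈ = Dec.dec-true (_ Bool.≟ _)
        (trans (val φ∈) (cong₂ _∧_ (sym (val (∧-subformulaˡ Φ φ∈))) (sym (val (∧-subformulaʳ Φ φ∈)))))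
      local (□' χ) φ∈ rewrite val φ∈ | val (□-subformula Φ φ∈) with propEval v (□' χ) in □χv
      ... | false = refl
      ... | true = ∨-true⁺ʳ (⇒-true⁻ v (□' χ) χ (All.lookup (All.map⁻ T-valid) φ∈) □χv)

  boxIncluded : Atom → Atom → Form → Bool
  boxIncluded a b (□' θ) = not (value a (□' θ)) ∨ value b (□' θ)
  boxIncluded a b _ = true

  infix 4.5 _↝_
  _↝_ : Atom → Atom → Bool
  a ↝ b = all (boxIncluded a b) L

  ↝-elim : ∀ {a b θ} → a ↝ b ≡ true → □' θ ∈ L → value a (□' θ) ≡ true → value b (□' θ) ≡ true
  ↝-elim {a} {b} {θ} a↝b θ∈ □θa with ∨-true⁻ (all-true⁻ (boxIncluded a b) a↝b θ∈)
  ... | inj₁ ¬□θa = ⊥-elim (true≢false □θa (not-true⁻ ¬□θa))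
  ... | inj₂ □θb = □θb

  ↝-intro : ∀ {a b} → (∀ {θ} → □' θ ∈ L → value a (□' θ) ≡ true → value b (□' θ) ≡ true) → a ↝ b ≡ true
  ↝-intro {a} {b} h = all-true⁺ (boxIncluded a b) L λ {φ} → included φ
    where
    included : ∀ φ → φ ∈ L → boxIncluded a b φ ≡ true
    included (var p) _ = refl
    included ⊤' _ = refl
    included (¬' φ) _ = refl
    included (φ ∧' ψ) _ = refl
    included (□' θ) θ∈ with value a (□' θ) in □θa
    ... | false = refl
    ... | true = h θ∈ □θa

  ↝-refl : ∀ a → a ↝ a ≡ true
  ↝-refl a = ↝-intro λ _ □θa → □θa

  ↝-trans : ∀ a b c → a ↝ b ≡ true → b ↝ c ≡ true → a ↝ c ≡ true
  ↝-trans a b c a↝b b↝c = ↝-intro λ θ∈ □θa → ↝-elim b↝c θ∈ (↝-elim a↝b θ∈ □θa)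

  refutesBox : Atom → Form → Atom → Bool
  refutesBox a χ b = (a ↝ b) ∧ not (value b χ)

  witnessedAt : List Atom → Atom → Form → Bool
  witnessedAt S a (□' χ) = value a (□' χ) ∨ any (refutesBox a χ) S
  witnessedAt S a _ = true

  viable : List Atom → Atom → Bool
  viable S a = consistent a ∧ all (witnessedAt S a) L

  EliminationInvariant : List Atom → Set
  EliminationInvariant S = ∀ {b} → b ∈ candidates → b ∉ S → Refuted b

  trueBox : Atom → Form → Bool
  trueBox a (□' θ) = value a (□' θ)
  trueBox a _ = false

  trueBox-IsBox : ∀ a φ → trueBox a φ ≡ true → IsBox φ
  trueBox-IsBox a (□' θ) _ = θ , refl

  -- Every atom that satisfies the true boxes of a and refutes χ has been discarded, so those
  -- boxes imply χ; by 4 they imply their own box, hence □χ, which is false in a.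
  refute-unwitnessed : ∀ {S} → EliminationInvariant S → ∀ {a χ} → a ∈ candidates → □' χ ∈ L →
                       value a (□' χ) ≡ false → any (refutesBox a χ) S ≡ false → Refuted a
  refute-unwitnessed {S} inv {a} {χ} a∈ □χ∈ □χa no-witness =
    refuted-by contradicts (boxes-4 necessary-boxed ∷ □-mono necessities⇒χ ∷ [])
    where
    trueBox? : ∀ φ → Dec (trueBox a φ ≡ true)
    trueBox? φ = trueBox a φ Bool.≟ true
    necessities : Form
    necessities = bigAnd (List.filter trueBox? L)
    necessary-boxed : All IsBox (List.filter trueBox? L)
    necessary-boxed = All.map (λ {φ} → trueBox-IsBox a φ) (All.all-filter trueBox? L)
    necessities⇒χ : ⊢ necessities ⇒' χ
    necessities⇒χ = derivable-if-refuted (refutesBox a χ)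
      (λ b∈ refutes → inv b∈ λ b∈S → true≢false refutes (any-false⁻ (refutesBox a χ) no-witness b∈S))
      (λ v ⇒χ-false → witness v (∧-true⁻ˡ (not-false⁻ ⇒χ-false))
                        (not-true⁻ (∧-true⁻ʳ {propEval v necessities} (not-false⁻ ⇒χ-false))))
      where
      witness : ∀ v → propEval v necessities ≡ true → propEval v χ ≡ false →
                refutesBox a χ (atomOf (propEval v) L) ≡ true
      witness v nec-v χv = ∧-true⁺
        (↝-intro λ {θ} θ∈ □θa → trans (value-atomOf (propEval v) L θ∈)
          (All.lookup (bigAnd-true⁻ v _ nec-v) (∈-filter⁺ trueBox? θ∈ □θa)))
        (not-true⁺ (trans (value-atomOf (propEval v) L (□-subformula Φ □χ∈)) χv))
    contradicts : ∀ v → AllTrue v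
                    ((necessities ⇒' □' necessities) ∷ (□' necessities ⇒' □' χ) ∷ []) →
                  propEval v (characteristic a) ≡ true → ⊥
    contradicts v (h₁ ∷ h₂ ∷ []) e = true≢false
      (⇒-true⁻ v (□' necessities) (□' χ) h₂ (⇒-true⁻ v necessities (□' necessities) h₁ nec-v))
      (trans (sym (value-characteristic v a∈ □χ∈ e)) □χa)
      where
      nec-v : propEval v necessities ≡ true
      nec-v = bigAnd-true⁺ v (All.tabulate λ φ∈ → case∈ (∈-filter⁻ trueBox? φ∈))
        where
        case∈ : ∀ {φ} → φ ∈ L × trueBox a φ ≡ true → propEval v φ ≡ true
        case∈ {□' θ} (φ∈ , □θa) = trans (sym (value-characteristic v a∈ φ∈ e)) □θa

  prune : List Atom → List Atom
  prune S = List.filter (λ a → viable S a Bool.≟ true) S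

  prune-invariant : ∀ {S} → EliminationInvariant S → EliminationInvariant (prune S)
  prune-invariant {S} inv {b} b∈ b∉ with b ∈? S
  ... | no b∉S = inv b∈ b∉S
  ... | yes b∈S with viable S b in viable-b
  ...   | true = ⊥-elim (b∉ (∈-filter⁺ (λ a → viable S a Bool.≟ true) b∈S viable-b))
  ...   | false with ∧-false⁻ viable-b
  ...     | inj₁ inconsistent = refute-inconsistent b∈ inconsistent
  ...     | inj₂ unwitnessed with all-false⁻ (witnessedAt S b) L unwitnessed
  ...       | □' χ , □χ∈ , no-witness with ∨-false⁻ no-witness
  ...         | □χb , none = refute-unwitnessed inv b∈ □χ∈ □χb none

  Stable : List Atom → Set
  Stable S = All (λ a → viable S a ≡ true) S

  stabilise : ∀ k S → List.length S ≤ k → EliminationInvariant S →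
              Σ[ S′ ∈ List Atom ] EliminationInvariant S′ × Stable S′
  stabilise k S len inv with All.all? (λ a → viable S a Bool.≟ true) S
  ... | yes stable = S , inv , stable
  stabilise zero [] len inv | no unstable = ⊥-elim (unstable [])
  stabilise (suc k) S len inv | no unstable =
    stabilise k (prune S) (ℕ.≤-pred (ℕ.<-≤-trans shrinks len)) (prune-invariant inv)
    where
    viable? : ∀ a → Dec (viable S a ≡ true)
    viable? a = viable S a Bool.≟ true
    shrinks : List.length (prune S) < List.length S
    shrinks = List.filter-notAll viable? S (All.¬All⇒Any¬ viable? S unstable)

  module CanonicalModel (S : List Atom) (stable : Stable S) where

    point : Fin (List.length S) → Atom
    point = List.lookup S

    R : Fin (List.length S) → Fin (List.length S) → Bool
    R i j = point i ↝ point j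

    V : ℕ → Fin (List.length S) → Bool
    V p i = value (point i) (var p)

    R-refl : Refl R
    R-refl i = ↝-refl (point i)

    R-trans : Trans R
    R-trans i j k = ↝-trans (point i) (point j) (point k)

    locally-consistent : ∀ i {φ} → φ ∈ L → locallyConsistentAt (point i) φ ≡ true
    locally-consistent i =
      all-true⁻ (locallyConsistentAt (point i)) (∧-true⁻ˡ (All.lookup stable (∈-lookup i)))

    witnessed : ∀ i {φ} → φ ∈ L → witnessedAt S (point i) φ ≡ true
    witnessed i =
      all-true⁻ (witnessedAt S (point i)) (∧-true⁻ʳ {consistent (point i)} (All.lookup stable (∈-lookup i)))

    open Semantics R V

    truth : ∀ φ → φ ∈ L → ∀ i → i ⊨ φ ≡ value (point i) φ
    truth (var p) _ i = refl
    truth ⊤' φ∈ i = sym (locally-consistent i φ∈)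
    truth (¬' χ) φ∈ i =
      trans (cong not (truth χ (¬-subformula Φ φ∈) i)) (sym (≟-true⁻ (locally-consistent i φ∈)))
    truth (χ ∧' θ) φ∈ i =
      trans (cong₂ _∧_ (truth χ (∧-subformulaˡ Φ φ∈) i) (truth θ (∧-subformulaʳ Φ φ∈) i))
            (sym (≟-true⁻ (locally-consistent i φ∈)))
    truth (□' χ) φ∈ i with value (point i) (□' χ) in □χi
    ... | true = □-intro χ λ j Rij → trans (truth χ (□-subformula Φ φ∈) j) (□-reflexive j (↝-elim Rij φ∈ □χi))
      where
      □-reflexive : ∀ j → value (point j) (□' χ) ≡ true → value (point j) χ ≡ true
      □-reflexive j □χj with ∨-true⁻ (locally-consistent j φ∈)
      ... | inj₁ ¬□χj = ⊥-elim (true≢false □χj (not-true⁻ ¬□χj))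
      ... | inj₂ χj = χj
    ... | false with ∨-true⁻ (witnessed i φ∈)
    ...   | inj₁ □χi′ = ⊥-elim (true≢false □χi′ □χi)
    ...   | inj₂ some with any-true⁻ (refutesBox (point i) χ) S some
    ...     | b , b∈S , refutes =
              □-false⁺ {u = j} χ (≡.subst (λ c → point i ↝ c ≡ true) b≡ (∧-true⁻ˡ refutes))
                (trans (truth χ (□-subformula Φ φ∈) j)
                       (≡.subst (λ c → value c χ ≡ false) b≡ (not-true⁻ (∧-true⁻ʳ {point i ↝ b} refutes))))
      where
      j : Fin (List.length S)
      j = Any.index b∈S
      b≡ : b ≡ point j
      b≡ = Any.lookup-index b∈S

    countermodel : ∀ {a} → a ∈ S → value a Φ ≡ false → FiniteCountermodel Φ
    countermodel a∈S Φa = List.length S , R , R-refl , R-trans , V , Any.index a∈S ,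
      trans (truth Φ (∈-subformulas-self Φ) (Any.index a∈S))
            (≡.subst (λ c → value c Φ ≡ false) (Any.lookup-index a∈S) Φa)

  derivable-or-countermodel : S4C n Φ ⊎ FiniteCountermodel Φ
  derivable-or-countermodel
    with stabilise (List.length candidates) candidates ℕ.≤-refl (λ b∈ b∉ → ⊥-elim (b∉ b∈))
  ... | S , inv , stable = decide S inv stable
    where
    falsifies : Atom → Bool
    falsifies a = not (value a Φ)
    decide : ∀ S → EliminationInvariant S → Stable S → S4C n Φ ⊎ FiniteCountermodel Φ
    decide S inv stable with any falsifies S in some-falsifies
    ... | true with any-true⁻ falsifies S some-falsifies
    ...   | a , a∈S , ¬Φa = inj₂ (CanonicalModel.countermodel S stable a∈S (not-true⁻ ¬Φa))
    decide S inv stable | false = inj₁ (derivable-if-refuted falsifies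
      (λ b∈ ¬Φb → inv b∈ λ b∈S → true≢false ¬Φb (any-false⁻ falsifies some-falsifies b∈S))
      (λ v Φv → not-true⁺ (trans (value-atomOf (propEval v) L (∈-subformulas-self Φ)) Φv)))

vectors : ∀ {A : Set} → List A → (k : ℕ) → List (Vec A k)
vectors xs zero = [] ∷ []
vectors xs (suc k) = List.cartesianProductWith _∷_ xs (vectors xs k)

∈-vectors : ∀ {A : Set} (xs : List A) {k} (v : Vec A k) → (∀ i → lookup v i ∈ xs) → v ∈ vectors xs k
∈-vectors xs [] _ = here refl
∈-vectors xs (x ∷ v) h = ∈-cartesianProductWith⁺ _∷_ (h zero) (∈-vectors xs v (λ i → h (suc i)))

instanceOf : ∀ {k} → Vec Atom (suc k) → Form
instanceOf (a ∷ as) = ℂ (characteristic a) (Vec.map characteristic as)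

ℂ-instances : ℕ → Form → Form
ℂ-instances n φ = bigAnd (List.map instanceOf (vectors (atoms (subformulas φ)) (suc n)))

ℂ-instances-derivable : ∀ n φ → S4C n (ℂ-instances n φ)
ℂ-instances-derivable n φ =
  Derivations.bigAnd-derivable n (All.map⁺ (All.tabulate λ {as} _ → instance-derivable as))
  where
  instance-derivable : (as : Vec Atom (suc n)) → S4C n (instanceOf as)
  instance-derivable (a ∷ as) = axC (characteristic a) (Vec.map characteristic as)

last-or-inject₁ : ∀ {k} (i : Fin (suc k)) → i ≡ fromℕ k ⊎ Σ[ i′ ∈ Fin k ] i ≡ inject₁ i′
last-or-inject₁ {zero} zero = inj₁ refl
last-or-inject₁ {suc k} zero = inj₂ (zero , refl)
last-or-inject₁ {suc k} (suc i) with last-or-inject₁ i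
... | inj₁ refl = inj₁ refl
... | inj₂ (i′ , refl) = inj₂ (suc i′ , refl)

module Path {m} (R : Fin m → Fin m → Bool) (R-refl : Refl R) (R-trans : Trans R) where

  Steps : ∀ j → (Fin (suc j) → Fin m) → Set
  Steps j x = ∀ i → R (x (inject₁ i)) (x (suc i)) ≡ true

  from-first : ∀ j x → Steps j x → ∀ i → R (x zero) (x i) ≡ true
  from-first zero x steps zero = R-refl _
  from-first (suc j) x steps i with last-or-inject₁ i
  ... | inj₁ refl = R-trans _ _ _ (from-first j (x ∘ inject₁) (steps ∘ inject₁) (fromℕ j)) (steps (fromℕ j))
  ... | inj₂ (i′ , refl) = from-first j (x ∘ inject₁) (steps ∘ inject₁) i′

  to-last : ∀ j x → Steps j x → ∀ i → R (x i) (x (fromℕ j)) ≡ true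
  to-last zero x steps zero = R-refl _
  to-last (suc j) x steps i with last-or-inject₁ i
  ... | inj₁ refl = R-refl _
  ... | inj₂ (i′ , refl) = R-trans _ _ _ (to-last j (x ∘ inject₁) (steps ∘ inject₁) i′) (steps (fromℕ j))

  cycle-cluster : ∀ j x → IsCycle R j x → ∀ s t → R (x s) (x t) ≡ true
  cycle-cluster j x (_ , steps , closing) s t =
    R-trans _ _ _ (to-last j x steps s) (R-trans _ _ _ closing (from-first j x steps t))

-- Within the cone of w, R′ keeps the edges into strictly higher points but, inside a
-- cluster, only the edges into essential points; every ◇-witness for a subformula of φ
-- can be moved to an essential point of its type.
module ClusterReduction {m} (R : Fin m → Fin m → Bool) (R-refl : Refl R) (R-trans : Trans R)
                        (V : ℕ → Fin m → Bool) (w : Fin m) (φ : Form) where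
  open Semantics R V

  L : List Form
  L = subformulas φ

  type : Fin m → Atom
  type x = atomOf (x ⊨_) L

  type-truth : ∀ {x y ψ} → type x ≡ type y → ψ ∈ L → x ⊨ ψ ≡ y ⊨ ψ
  type-truth {x} {y} {ψ} eq ψ∈ =
    trans (sym (value-atomOf (x ⊨_) L ψ∈)) (trans (cong (λ a → value a ψ) eq) (value-atomOf (y ⊨_) L ψ∈))

  characteristic-type : ∀ x → x ⊨ characteristic (type x) ≡ true
  characteristic-type x = trans (sym (propEval-sat R V x (characteristic (type x))))
    (characteristic-atomOf (x ⊨_) (x ⊨_) L λ {ψ} _ → sym (propEval-sat R V x ψ))

  type-of-characteristic : ∀ u x → u ⊨ characteristic (type x) ≡ true → type u ≡ type x
  type-of-characteristic u x e = atomOf-cong L λ {ψ} ψ∈ →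
    trans (sym (propEval-sat R V u ψ))
      (characteristic-true⁻ (u ⊨_) (type x) (trans (propEval-sat R V u (characteristic (type x))) e)
        (∈-map⁺ (λ ψ → ψ , x ⊨ ψ) ψ∈))

  HigherTwin : Fin m → Fin m → Set
  HigherTwin x y = R x y ≡ true × R y x ≡ false × type x ≡ type y

  LowerTwin : Fin m → Fin m → Set
  LowerTwin y z = toℕ z < toℕ y × R y z ≡ true × R z y ≡ true × type y ≡ type z

  Essential : Fin m → Set
  Essential y = ¬ Σ (Fin m) (LowerTwin y) × ¬ Σ (Fin m) (HigherTwin y)

  higherTwin? : ∀ x y → Dec (HigherTwin x y)
  higherTwin? x y = R x y Bool.≟ true ×-dec R y x Bool.≟ false ×-dec type x ≟ᵃ type y

  essential? : ∀ y → Dec (Essential y)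
  essential? y = ¬? (Fin.any? lowerTwin?) ×-dec ¬? (Fin.any? (higherTwin? y))
    where
    lowerTwin? : ∀ z → Dec (LowerTwin y z)
    lowerTwin? z = toℕ z ℕ.<? toℕ y ×-dec R y z Bool.≟ true ×-dec R z y Bool.≟ true ×-dec type y ≟ᵃ type z

  R′ : Fin m → Fin m → Bool
  R′ x y = does (x Fin.≟ y) ∨ (R w x ∧ (R x y ∧ (not (R y x) ∨ does (essential? y))))

  R′-cases : ∀ {x y} → R′ x y ≡ true →
             x ≡ y ⊎ (R w x ≡ true × R x y ≡ true × (R y x ≡ false ⊎ Essential y))
  R′-cases {x} {y} e with x Fin.≟ y
  ... | yes x≡y = inj₁ x≡y
  ... | no _ = inj₂ (∧-true⁻ˡ e , ∧-true⁻ˡ (∧-true⁻ʳ {R w x} e) ,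
                    kind (∨-true⁻ (∧-true⁻ʳ {R x y} (∧-true⁻ʳ {R w x} e))))
    where
    kind : not (R y x) ≡ true ⊎ does (essential? y) ≡ true → R y x ≡ false ⊎ Essential y
    kind (inj₁ strict) = inj₁ (not-true⁻ strict)
    kind (inj₂ essential) = inj₂ (does-true⁻ (essential? y) essential)

  R′-strict : ∀ {x y} → R w x ≡ true → R x y ≡ true → R y x ≡ false → R′ x y ≡ true
  R′-strict {x} {y} Rwx Rxy Ryx =
    ∨-true⁺ʳ {does (x Fin.≟ y)} (∧-true⁺ Rwx (∧-true⁺ Rxy (∨-true⁺ˡ (not-true⁺ Ryx))))

  R′-essential : ∀ {x y} → R w x ≡ true → R x y ≡ true → Essential y → R′ x y ≡ true
  R′-essential {x} {y} Rwx Rxy ess =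
    ∨-true⁺ʳ {does (x Fin.≟ y)}
      (∧-true⁺ Rwx (∧-true⁺ Rxy (∨-true⁺ʳ {not (R y x)} (Dec.dec-true (essential? y) ess))))

  R′-refl : Refl R′
  R′-refl x = ∨-true⁺ˡ (Dec.dec-true (x Fin.≟ x) refl)

  R′⊆R : ∀ {x y} → R′ x y ≡ true → R x y ≡ true
  R′⊆R e with R′-cases e
  ... | inj₁ refl = R-refl _
  ... | inj₂ (_ , Rxy , _) = Rxy

  R′-trans : Trans R′
  R′-trans x y z e₁ e₂ with R′-cases e₁ | R′-cases e₂
  ... | inj₁ refl | _ = e₂
  ... | inj₂ _ | inj₁ refl = e₁
  ... | inj₂ (Rwx , Rxy , _) | inj₂ (_ , Ryz , inj₂ ess) = R′-essential Rwx (R-trans x y z Rxy Ryz) ess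
  ... | inj₂ (Rwx , Rxy , _) | inj₂ (_ , Ryz , inj₁ Rzy) = R′-strict Rwx (R-trans x y z Rxy Ryz) Rzx
    where
    Rzx : R z x ≡ false
    Rzx with R z x in e
    ... | false = refl
    ... | true = ⊥-elim (true≢false (R-trans z x y e Rxy) Rzy)

  least-twin : ∀ u → Σ[ r ∈ Fin m ] R u r ≡ true × R r u ≡ true × type u ≡ type r × ¬ Σ (Fin m) (LowerTwin r)
  least-twin u with minimiser (λ z → R u z ∧ R z u ∧ does (type u ≟ᵃ type z)) toℕ
                      (∧-true⁺ (R-refl u) (∧-true⁺ (R-refl u) (Dec.dec-true (type u ≟ᵃ type u) refl)))
  ... | r , twin , least = r , Rur , Rru , ur , no-lower
    where
    Rur : R u r ≡ true
    Rur = ∧-true⁻ˡ twin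
    Rru : R r u ≡ true
    Rru = ∧-true⁻ˡ (∧-true⁻ʳ {R u r} twin)
    ur : type u ≡ type r
    ur = does-true⁻ (type u ≟ᵃ type r) (∧-true⁻ʳ {R r u} (∧-true⁻ʳ {R u r} twin))
    no-lower : ¬ Σ (Fin m) (LowerTwin r)
    no-lower (z , z<r , Rrz , Rzr , rz) = ℕ.<⇒≱ z<r (least z
      (∧-true⁺ (R-trans u r z Rur Rrz)
               (∧-true⁺ (R-trans z r u Rzr Rru) (Dec.dec-true (type u ≟ᵃ type z) (trans ur rz)))))

  essential-twins-equal : ∀ {a b} → Essential a → Essential b → R a b ≡ true → R b a ≡ true →
                          type a ≡ type b → a ≡ b
  essential-twins-equal {a} {b} (no-lower-a , _) (no-lower-b , _) Rab Rba ab with Fin.<-cmp a b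
  ... | tri≈ _ a≡b _ = a≡b
  ... | tri< a<b _ _ = ⊥-elim (no-lower-b (a , a<b , Rba , Rab , sym ab))
  ... | tri> _ _ b<a = ⊥-elim (no-lower-a (b , b<a , Rab , Rba , ab))

  R′-witness : ∀ {x u χ} → χ ∈ L → R w x ≡ true → R x u ≡ true → u ⊨ χ ≡ false →
               Σ[ v ∈ Fin m ] R′ x v ≡ true × R w v ≡ true × v ⊨ χ ≡ false
  R′-witness {x} {u} {χ} χ∈ Rwx Rxu χu with R u x in Rux
  ... | false = u , R′-strict Rwx Rxu Rux , R-trans w x u Rwx Rxu , χu
  ... | true with Fin.any? (higherTwin? u)
  ...   | yes (y , Ruy , Ryu , uy) =
          y , R′-strict Rwx (R-trans x u y Rxu Ruy) Ryx , R-trans w u y (R-trans w x u Rwx Rxu) Ruy ,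
          trans (sym (type-truth uy χ∈)) χu
    where
    Ryx : R y x ≡ false
    Ryx with R y x in e
    ... | false = refl
    ... | true = ⊥-elim (true≢false (R-trans y x u e Rxu) Ryu)
  ...   | no no-higher with least-twin u
  ...     | r , Rur , Rru , ur , no-lower =
            r , R′-essential Rwx (R-trans x u r Rxu Rur) (no-lower , no-higher-r) ,
            R-trans w u r (R-trans w x u Rwx Rxu) Rur , trans (sym (type-truth ur χ∈)) χu
    where
    no-higher-r : ¬ Σ (Fin m) (HigherTwin r)
    no-higher-r (y , Rry , Ryr , ry) = no-higher (y , R-trans u r y Rur Rry , Ryu , trans ur ry)
      where
      Ryu : R y u ≡ false
      Ryu with R y u in e
      ... | false = refl
      ... | true = ⊥-elim (true≢false (R-trans y u r e Rur) Ryr)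

  truth : ∀ ψ → ψ ∈ L → ∀ x → R w x ≡ true → sat R′ V x ψ ≡ x ⊨ ψ
  truth (var p) _ x _ = refl
  truth ⊤' _ x _ = refl
  truth (¬' ψ) ψ∈ x Rwx = cong not (truth ψ (¬-subformula φ ψ∈) x Rwx)
  truth (ψ ∧' θ) ψ∈ x Rwx =
    cong₂ _∧_ (truth ψ (∧-subformulaˡ φ ψ∈) x Rwx) (truth θ (∧-subformulaʳ φ ψ∈) x Rwx)
  truth (□' χ) ψ∈ x Rwx with x ⊨ □' χ in □χx
  ... | true = Semantics.□-intro R′ V χ λ u R′xu →
          trans (truth χ (□-subformula φ ψ∈) u (R-trans w x u Rwx (R′⊆R R′xu))) (□-elim χ □χx (R′⊆R R′xu))
  ... | false with □-false⁻ χ □χx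
  ...   | u , Rxu , χu with R′-witness (□-subformula φ ψ∈) Rwx Rxu χu
  ...     | v , R′xv , Rwv , χv =
            Semantics.□-false⁺ R′ V χ R′xv (trans (truth χ (□-subformula φ ψ∈) v Rwv) χv)

  R′-cycle-essential : ∀ j x → IsCycle R′ (suc j) x →
    (∀ s t → R (x s) (x t) ≡ true) × R w (x zero) ≡ true × (∀ s → Essential (x s))
  R′-cycle-essential j x (injective , steps , closing) = cluster , proj₁ (proper-step zero) , essential
    where
    proper : ∀ {s t} → s ≢ t → R′ (x s) (x t) ≡ true →
             R w (x s) ≡ true × R (x s) (x t) ≡ true × (R (x t) (x s) ≡ false ⊎ Essential (x t))
    proper s≢t e with R′-cases e
    ... | inj₁ xs≡xt = ⊥-elim (s≢t (injective _ _ xs≡xt))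
    ... | inj₂ edge = edge
    proper-step : ∀ i → R w (x (inject₁ i)) ≡ true × R (x (inject₁ i)) (x (suc i)) ≡ true ×
                        (R (x (suc i)) (x (inject₁ i)) ≡ false ⊎ Essential (x (suc i)))
    proper-step i = proper (λ e → ℕ.1+n≢n (sym (trans (sym (Fin.toℕ-inject₁ i)) (cong toℕ e)))) (steps i)
    proper-closing : R w (x (fromℕ (suc j))) ≡ true × R (x (fromℕ (suc j))) (x zero) ≡ true ×
                     (R (x zero) (x (fromℕ (suc j))) ≡ false ⊎ Essential (x zero))
    proper-closing = proper (λ ()) closing
    cluster : ∀ s t → R (x s) (x t) ≡ true
    cluster = Path.cycle-cluster R R-refl R-trans (suc j) x
                (injective , (λ i → proj₁ (proj₂ (proper-step i))) , proj₁ (proj₂ proper-closing))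
    not-strict : ∀ {s t} → R (x t) (x s) ≡ false ⊎ Essential (x t) → Essential (x t)
    not-strict {s} {t} (inj₁ Rts) = ⊥-elim (true≢false (cluster t s) Rts)
    not-strict (inj₂ ess) = ess
    essential : ∀ s → Essential (x s)
    essential zero = not-strict (proj₂ (proj₂ proper-closing))
    essential (suc i) = not-strict (proj₂ (proj₂ (proper-step i)))

  module _ (n : ℕ) (□instances : w ⊨ □' ℂ-instances n φ ≡ true) where

    module _ (x : Fin (suc n) → Fin m) (cluster : ∀ s t → R (x s) (x t) ≡ true) (Rwx₀ : R w (x zero) ≡ true)
             (distinct-types : ∀ s t → type (x s) ≡ type (x t) → s ≡ t) where

      x₀ : Fin m
      x₀ = x zero

      A : Form
      A = characteristic (type x₀)

      As : Vec Form n
      As = Vec.map characteristic (tabulate (type ∘ x ∘ suc))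

      label : ∀ s → lookup (A ∷ As) s ≡ characteristic (type (x s))
      label zero = refl
      label (suc i) = trans (Vec.lookup-map i characteristic (tabulate (type ∘ x ∘ suc)))
                            (cong characteristic (Vec.lookup∘tabulate (type ∘ x ∘ suc) i))

      instance-holds : x₀ ⊨ ℂ A As ≡ true
      instance-holds = trans (sym (propEval-sat R V x₀ (ℂ A As)))
        (All.lookup (PropositionalValuation.bigAnd-true⁻ (x₀ ⊨_) instances
                      (trans (propEval-sat R V x₀ (bigAnd instances))
                             (□-elim (ℂ-instances n φ) □instances Rwx₀)))
          (∈-map⁺ instanceOf (∈-vectors (atoms L) (tabulate (type ∘ x))
            λ i → ≡.subst (_∈ atoms L) (sym (Vec.lookup∘tabulate (type ∘ x) i)) (atomOf-∈-atoms (x i ⊨_) L))))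
        where
        instances : List Form
        instances = List.map instanceOf (vectors (atoms L) (suc n))

      exclusive : ∀ u → u ⊨ 𝔻 (A ∷ As) ≡ true
      exclusive u = 𝔻-intro (A ∷ As) excl
        where
        type-from : ∀ s → u ⊨ lookup (A ∷ As) s ≡ true → type u ≡ type (x s)
        type-from s e = type-of-characteristic u (x s) (≡.subst (λ ψ → u ⊨ ψ ≡ true) (label s) e)
        excl : ∀ s t → s ≢ t → u ⊨ lookup (A ∷ As) s ≡ true → u ⊨ lookup (A ∷ As) t ≡ false
        excl s t s≢t us with u ⊨ lookup (A ∷ As) t in ut
        ... | false = refl
        ... | true = ⊥-elim (s≢t (distinct-types s t (trans (sym (type-from s us)) (type-from t ut))))

      ◇-witness : x₀ ⊨ ◇' (A ∧' ¬' ℙ A As) ≡ true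
      ◇-witness = ⇒-elim (◇' A) (◇' (A ∧' ¬' ℙ A As))
        (⇒-elim (□* 𝔻 (A ∷ As)) (◇' A ⇒' ◇' (A ∧' ¬' ℙ A As)) instance-holds
          (∧-true⁺ (exclusive x₀) (□-intro (𝔻 (A ∷ As)) λ u _ → exclusive u)))
        (◇-intro A (R-refl x₀) (characteristic-type x₀))

      -- ℂₙ instantiated at x₀ with the types of x₀, …, xₙ yields a point y of the type of x₀
      -- refuting ℙ; y cannot lie strictly above x₀, and inside the cluster the points
      -- x₁, …, xₙ, x₀ witness ℙ at y.
      no-large-cluster : ¬ Σ (Fin m) (HigherTwin x₀) → ⊥
      no-large-cluster no-higher with ◇-elim (A ∧' ¬' ℙ A As) ◇-witness
      ... | y , Rx₀y , h with R y x₀ in Ryx₀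
      ...   | false = no-higher (y , Rx₀y , Ryx₀ , sym (type-of-characteristic y x₀ (∧-true⁻ˡ h)))
      ...   | true = true≢false (ℙ-intro A As (tabulate (x ∘ suc)) path on-path (characteristic-type x₀))
                       (not-true⁻ (∧-true⁻ʳ {y ⊨ A} h))
        where
        InCluster : Fin m → Set
        InCluster z = R y z ≡ true × R z y ≡ true
        x-in-cluster : ∀ s → InCluster (x s)
        x-in-cluster s = R-trans y x₀ (x s) Ryx₀ (cluster zero s) , R-trans (x s) x₀ y (cluster s zero) Rx₀y
        path : Chain R y (tabulate (x ∘ suc)) x₀
        path = chain-within InCluster (λ (_ , Ray) (Ryb , _) → R-trans _ y _ Ray Ryb) (tabulate (x ∘ suc))
                 (R-refl y , R-refl y)
                 (λ i → ≡.subst InCluster (sym (Vec.lookup∘tabulate (x ∘ suc) i)) (x-in-cluster (suc i)))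
                 (x-in-cluster zero)
        on-path : ∀ i → lookup (tabulate (x ∘ suc)) i ⊨ lookup As i ≡ true
        on-path i rewrite Vec.lookup∘tabulate (x ∘ suc) i | label (suc i) = characteristic-type (x (suc i))

    R′-circumference : 1 ≤ n → CircumferenceAtMost n R′
    R′-circumference 1≤n zero x _ = 1≤n
    R′-circumference 1≤n (suc j) x cycle with suc (suc j) ℕ.≤? n
    ... | yes fits = fits
    ... | no too-long with R′-cycle-essential j x cycle
    ...   | cluster , Rwx₀ , essential =
            ⊥-elim (no-large-cluster (x ∘ embed) (λ s t → cluster (embed s) (embed t)) Rwx₀ distinct-types
                      (proj₂ (essential zero)))
      where
      n<J : suc n ≤ suc (suc j)
      n<J = ℕ.≰⇒> too-long
      embed : Fin (suc n) → Fin (suc (suc j))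
      embed i = Fin.inject≤ i n<J
      distinct-types : ∀ s t → type (x (embed s)) ≡ type (x (embed t)) → s ≡ t
      distinct-types s t eq = Fin.inject≤-injective n<J n<J s t (proj₁ cycle _ _
        (essential-twins-equal (essential _) (essential _) (cluster _ _) (cluster _ _) eq))

    reduced-countermodel : 1 ≤ n → w ⊨ φ ≡ false → ¬ ValidFinS4Circ n φ
    reduced-countermodel 1≤n φw valid = true≢false
      (trans (sym (truth φ (∈-subformulas-self φ) w (R-refl w)))
             (valid m R′ R′-refl R′-trans (R′-circumference 1≤n) V w))
      φw

completeness : ∀ n → 1 ≤ n → ∀ φ → ValidFinS4Circ n φ → S4C n φ
completeness n 1≤n φ valid with Elimination.derivable-or-countermodel n (□' ℂ-instances n φ ⇒' φ)
... | inj₁ □instances⇒φ = mp □instances⇒φ (nec (ℂ-instances-derivable n φ))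
... | inj₂ (m , R , R-refl , R-trans , V , w , refuted) =
  ⊥-elim (ClusterReduction.reduced-countermodel R R-refl R-trans V w φ n
            (∧-true⁻ˡ (not-false⁻ refuted)) 1≤n
            (not-true⁻ (∧-true⁻ʳ {sat R V w (□' ℂ-instances n φ)} (not-false⁻ refuted))) valid)

mainTheorem10 : (n : ℕ) → 1 ≤ n → (φ : Form) →
    (S4C n φ → ValidFinS4Circ n φ) × (ValidFinS4Circ n φ → S4C n φ)
mainTheorem10 n 1≤n φ = sound n , completeness n 1≤n φ
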